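{- For every integer $d\ge 2$, \[ \lim_{k\to\infty} R(3;k)^{1/k} \ge 2^{(d-1)/(\chi_2(d)-1)}. \]
   Context: $R(3;k)$ is the smallest $N$ such that every coloring of the edges of the complete graph $K_N$ with $k$ colors contains a monochromatic triangle. $\chi_2(d)$ denotes the minimum number of colors needed to color the nonzero vectors of $\mathbb{F}_2^d$ (the points of $\mathrm{PG}(d-1,2)$) so that no triple $\{x,y,x+y\}$ with $x\ne y$ nonzero is monochromatic. -}

module Defs where

open import Data.Nat using (ℕ; _≤_)
open import Data.Fin using (Fin) renaming (_<_ to _<ᶠ_)
open import Data.Fin.Properties using (<-trans)
open import Data.Bool using (Bool; false; _xor_)
open import Data.Vec using (Vec; replicate; zipWith)
open import Data.Product using (Σ; ∃-syntax; _×_)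
open import Relation.Binary.PropositionalEquality using (_≡_; _≢_)
open import Relation.Nullary using (¬_)

EdgeColouring : ℕ → ℕ → Set
EdgeColouring N k = (i j : Fin N) → i <ᶠ j → Fin k

HasMonoTriangle : ∀ {N k} → EdgeColouring N k → Set
HasMonoTriangle {N} f =
  ∃[ x ] ∃[ y ] ∃[ z ] Σ (x <ᶠ y) λ p → Σ (y <ᶠ z) λ q →
    (f x y p ≡ f y z q) × (f x y p ≡ f x z (<-trans p q))

Arrows : ℕ → ℕ → Set
Arrows k N = (f : EdgeColouring N k) → HasMonoTriangle f

IsR3 : ℕ → ℕ → Set
IsR3 k N = Arrows k N × ((M : ℕ) → Arrows k M → N ≤ M)

F2Vec : ℕ → Set
F2Vec d = Vec Bool d

_⊕_ : ∀ {d} → F2Vec d → F2Vec d → F2Vec d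
_⊕_ = zipWith _xor_

NonZero₂ : ∀ {d} → F2Vec d → Set
NonZero₂ {d} x = x ≢ replicate d false

-- A colouring of the nonzero vectors of F_2^d with m colours with no
-- monochromatic triple {x, y, x+y} (x ≠ y nonzero).  (Colours assigned to the
-- zero vector are irrelevant.)
GoodColouring : (d m : ℕ) → (F2Vec d → Fin m) → Set
GoodColouring d m c =
  (x y : F2Vec d) → NonZero₂ x → NonZero₂ y → x ≢ y →
    ¬ ((c x ≡ c y) × (c x ≡ c (x ⊕ y)))

Colourable₂ : ℕ → ℕ → Set
Colourable₂ d m = Σ (F2Vec d → Fin m) (GoodColouring d m)

IsChi2 : ℕ → ℕ → Set
IsChi2 d m = Colourable₂ d m × ((m' : ℕ) → Colourable₂ d m' → m ≤ m')

{-# OPTIONS --safe #-}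
-- A good colouring c of F₂^D with m colours gives the edge colouring {u, v} ↦ c (u + v) of
-- the complete graph on F₂^D: a monochromatic triangle u, v, w would make u + v, v + w, u + w
-- a monochromatic triple.  Hence R(3; m) > 2^D.
--
-- Good colourings multiply.  Let c₁ colour F₂^d₁ with colours 0, …, m₁ and c₂ colour
-- F₂^(1+d₂) with m₂ colours.  Colour (q, w) ∈ F₂^d₁ × F₂^d₂ by c₁ q if q ≠ 0 and c₁ q ≠ 0,
-- and by c₂ ([q ≠ 0], w) otherwise.  In a triple (q, w), (q', w'), (q + q', w + w') either
-- q, q' and q + q' are all nonzero, and a monochromatic triple is monochromatic for c₁, or
-- one of them vanishes; then the collapse (q, w) ↦ ([q ≠ 0], w) is additive on the triple,
-- which becomes monochromatic for c₂.  Iterating, F₂^(1 + j(d-1)) has a good colouring with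
-- 1 + j(χ-1) colours, so R(3; k) > 2^(j(d-1)) as soon as k ≥ 1 + j(χ-1).  Writing
-- k = 1 + r + j(χ-1) with r < χ-1, Bernoulli's inequality absorbs the leftover factor
-- a^(r+1) ≤ a^(χ-1) once j ≥ a^(2(χ-1)).
module Submission where

open import Defs
open import Data.Bool using (Bool; true; false; not; _xor_; if_then_else_)
open import Data.Bool.Properties using (_≟_; xor-assoc; xor-identityˡ; xor-identityʳ; xor-same)
open import Data.Empty using (⊥; ⊥-elim)
open import Data.Fin using (Fin; zero; suc; inject≤; join; splitAt; remQuot; combine)
  renaming (_<_ to _<ᶠ_)
open import Data.Fin.Properties
  using (¬Fin0; inject≤-injective; splitAt-join; combine-remQuot; <⇒≢; <-trans)
open import Data.Nat
  using (ℕ; zero; suc; _+_; _*_; _^_; _∸_; _≤_; _<_; z≤n; s≤s; _≤?_; NonZero; >-nonZero)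
open import Data.Nat.DivMod
  using (_/_; _%_; m≡m%n+[m/n]*n; m%n<n; m*n/n≡m; m/n*n≤m; /-monoˡ-≤)
open import Data.Nat.Properties
  using (*-commutativeSemigroup; +-suc; *-comm; [m*n]*[o*p]≡[m*o]*[n*p];
         ^-*-assoc; ^-distribˡ-+-*; ^-monoˡ-≤; ^-monoʳ-≤;
         *-monoˡ-≤; *-monoʳ-≤; *-mono-≤; *-cancelˡ-≤;
         ≤-reflexive; ≤-trans; m≤m+n; m≤n+m; n≤1+n; <⇒≤; ≰⇒>; module ≤-Reasoning)
open import Data.Nat.Tactic.RingSolver using (solve-∀)
open import Algebra.Properties.CommutativeSemigroup *-commutativeSemigroup
  using (x∙yz≈y∙xz; x∙yz≈z∙yx)
open import Data.Product using (∃-syntax; _×_; _,_; proj₁; proj₂; uncurry)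
open import Data.Sum using (_⊎_; inj₁; inj₂; [_,_]′)
open import Data.Sum.Properties using (inj₁-injective; inj₂-injective)
open import Data.Vec using ([]; _∷_; replicate; _++_; take; drop)
open import Data.Vec.Properties
  using (∷-injective; ≡-dec; zipWith-assoc; zipWith-identityˡ; zipWith-identityʳ;
         take-zipWith; drop-zipWith; take++drop≡id)
open import Function using (_∘_)
open import Function.Definitions using (Injective)
open import Relation.Binary.PropositionalEquality
open import Relation.Nullary using (¬_; Dec; does; yes; no)
open import Relation.Nullary.Decidable using (dec-true; dec-false; toSum)

private
  variable
    d d₁ d₂ m m₁ m₂ : ℕ

0₂ : F2Vec d
0₂ = replicate _ false

_≟₂_ : (x y : F2Vec d) → Dec (x ≡ y)
_≟₂_ = ≡-dec _≟_

⊕-assoc : (x y z : F2Vec d) → (x ⊕ y) ⊕ z ≡ x ⊕ (y ⊕ z)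
⊕-assoc = zipWith-assoc xor-assoc

⊕-identityˡ : (x : F2Vec d) → 0₂ ⊕ x ≡ x
⊕-identityˡ = zipWith-identityˡ xor-identityˡ

⊕-identityʳ : (x : F2Vec d) → x ⊕ 0₂ ≡ x
⊕-identityʳ = zipWith-identityʳ xor-identityʳ

⊕-self : (x : F2Vec d) → x ⊕ x ≡ 0₂
⊕-self []      = refl
⊕-self (a ∷ x) = cong₂ _∷_ (xor-same a) (⊕-self x)

≡⇒⊕≡0₂ : {x y : F2Vec d} → x ≡ y → x ⊕ y ≡ 0₂
≡⇒⊕≡0₂ {x = x} refl = ⊕-self x

⊕≡0₂⇒≡ : {x y : F2Vec d} → x ⊕ y ≡ 0₂ → x ≡ y
⊕≡0₂⇒≡ {x = x} {y} x⊕y≡0 = begin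
  x             ≡⟨ ⊕-identityʳ x ⟨
  x ⊕ 0₂        ≡⟨ cong (x ⊕_) (⊕-self y) ⟨
  x ⊕ (y ⊕ y)   ≡⟨ ⊕-assoc x y y ⟨
  (x ⊕ y) ⊕ y   ≡⟨ cong (_⊕ y) x⊕y≡0 ⟩
  0₂ ⊕ y        ≡⟨ ⊕-identityˡ y ⟩
  y             ∎
  where open ≡-Reasoning

⊕-telescope : (x y z : F2Vec d) → (x ⊕ y) ⊕ (y ⊕ z) ≡ x ⊕ z
⊕-telescope x y z = begin
  (x ⊕ y) ⊕ (y ⊕ z)   ≡⟨ ⊕-assoc x y (y ⊕ z) ⟩
  x ⊕ (y ⊕ (y ⊕ z))   ≡⟨ cong (x ⊕_) (⊕-assoc y y z) ⟨
  x ⊕ ((y ⊕ y) ⊕ z)   ≡⟨ cong (λ v → x ⊕ (v ⊕ z)) (⊕-self y) ⟩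
  x ⊕ (0₂ ⊕ z)        ≡⟨ cong (x ⊕_) (⊕-identityˡ z) ⟩
  x ⊕ z               ∎
  where open ≡-Reasoning

replicate-++ : ∀ {A : Set} m {n} (a : A) → replicate m a ++ replicate n a ≡ replicate (m + n) a
replicate-++ zero    a = refl
replicate-++ (suc m) a = cong (a ∷_) (replicate-++ m a)

zero-or-nonZero : (x : F2Vec d) → x ≡ 0₂ ⊎ NonZero₂ x
zero-or-nonZero x = toSum (x ≟₂ 0₂)

isNonZero : F2Vec d → Bool
isNonZero x = not (does (x ≟₂ 0₂))

isNonZero-zero : {x : F2Vec d} → x ≡ 0₂ → isNonZero x ≡ false
isNonZero-zero {x = x} x≡0 = cong not (dec-true (x ≟₂ 0₂) x≡0)

isNonZero-nonZero : {x : F2Vec d} → NonZero₂ x → isNonZero x ≡ true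
isNonZero-nonZero {x = x} x≢0 = cong not (dec-false (x ≟₂ 0₂) x≢0)

isNonZero≡false⇒≡0₂ : {x : F2Vec d} → isNonZero x ≡ false → x ≡ 0₂
isNonZero≡false⇒≡0₂ {x = x} _  with x ≟₂ 0₂
isNonZero≡false⇒≡0₂         _  | yes x≡0 = x≡0
isNonZero≡false⇒≡0₂         () | no _

AllNonZero SomeZero : F2Vec d → F2Vec d → Set
AllNonZero q q' = NonZero₂ q × NonZero₂ q' × NonZero₂ (q ⊕ q')
SomeZero   q q' = q ≡ 0₂ ⊎ q' ≡ 0₂ ⊎ q ⊕ q' ≡ 0₂

allNonZero-or-someZero : (q q' : F2Vec d) → AllNonZero q q' ⊎ SomeZero q q'
allNonZero-or-someZero q q' with zero-or-nonZero q | zero-or-nonZero q' | zero-or-nonZero (q ⊕ q')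
... | inj₁ q≡0 | _         | _        = inj₂ (inj₁ q≡0)
... | inj₂ _   | inj₁ q'≡0 | _        = inj₂ (inj₂ (inj₁ q'≡0))
... | inj₂ _   | inj₂ _    | inj₁ s≡0 = inj₂ (inj₂ (inj₂ s≡0))
... | inj₂ q≢0 | inj₂ q'≢0 | inj₂ s≢0 = inj₁ (q≢0 , q'≢0 , s≢0)

isNonZero-⊕ : {q q' : F2Vec d} → SomeZero q q' → isNonZero (q ⊕ q') ≡ isNonZero q xor isNonZero q'
isNonZero-⊕ {q = q} {q'} (inj₁ q≡0) = begin
  isNonZero (q ⊕ q')              ≡⟨ cong (λ v → isNonZero (v ⊕ q')) q≡0 ⟩
  isNonZero (0₂ ⊕ q')             ≡⟨ cong isNonZero (⊕-identityˡ q') ⟩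
  isNonZero q'                    ≡⟨ cong (_xor isNonZero q') (isNonZero-zero q≡0) ⟨
  isNonZero q xor isNonZero q'    ∎
  where open ≡-Reasoning
isNonZero-⊕ {q = q} {q'} (inj₂ (inj₁ q'≡0)) = begin
  isNonZero (q ⊕ q')              ≡⟨ cong (λ v → isNonZero (q ⊕ v)) q'≡0 ⟩
  isNonZero (q ⊕ 0₂)              ≡⟨ cong isNonZero (⊕-identityʳ q) ⟩
  isNonZero q                     ≡⟨ xor-identityʳ (isNonZero q) ⟨
  isNonZero q xor false           ≡⟨ cong (isNonZero q xor_) (isNonZero-zero q'≡0) ⟨
  isNonZero q xor isNonZero q'    ∎
  where open ≡-Reasoning
isNonZero-⊕ {q = q} {q'} (inj₂ (inj₂ q⊕q'≡0)) = begin
  isNonZero (q ⊕ q')              ≡⟨ isNonZero-zero q⊕q'≡0 ⟩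
  false                           ≡⟨ xor-same (isNonZero q) ⟨
  isNonZero q xor isNonZero q     ≡⟨ cong (λ v → isNonZero q xor isNonZero v) (⊕≡0₂⇒≡ q⊕q'≡0) ⟩
  isNonZero q xor isNonZero q'    ∎
  where open ≡-Reasoning

Good : {A : Set} → (F2Vec d → A) → Set
Good {d} c = (x y : F2Vec d) → NonZero₂ x → NonZero₂ y → x ≢ y →
             ¬ ((c x ≡ c y) × (c x ≡ c (x ⊕ y)))

recolour : {A : Set} {c : F2Vec d → A} → Good c →
           (f : A → Fin m) → Injective _≡_ _≡_ f → Colourable₂ d m
recolour {c = c} good f f-injective =
  f ∘ c , λ x y x≢0 y≢0 x≢y (e₁ , e₂) → good x y x≢0 y≢0 x≢y (f-injective e₁ , f-injective e₂)

Colourable₂-weaken : {m' : ℕ} → Colourable₂ d m → m ≤ m' → Colourable₂ d m'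
Colourable₂-weaken (_ , good) m≤m' =
  recolour good (λ i → inject≤ i m≤m') (inject≤-injective m≤m' m≤m' _ _)

Colourable₂-1-1 : Colourable₂ 1 1
Colourable₂-1-1 =
  (λ _ → zero) , λ x y x≢0 y≢0 x≢y _ → x≢y (trans (unique x x≢0) (sym (unique y y≢0)))
  where
  unique : (x : F2Vec 1) → NonZero₂ x → x ≡ true ∷ []
  unique (true  ∷ []) _   = refl
  unique (false ∷ []) x≢0 = ⊥-elim (x≢0 refl)

¬Colourable₂-1 : 2 ≤ d → ¬ Colourable₂ d 1
¬Colourable₂-1 (s≤s (s≤s z≤n)) (c , good) =
  good (true ∷ 0₂) (false ∷ true ∷ 0₂) (λ ()) (λ ()) (λ ()) (Fin1-unique _ _ , Fin1-unique _ _)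
  where
  Fin1-unique : (i j : Fin 1) → i ≡ j
  Fin1-unique zero zero = refl

join-injective : ∀ m n → Injective _≡_ _≡_ (join m n)
join-injective m n {i} {j} eq = begin
  i                       ≡⟨ splitAt-join m n i ⟨
  splitAt m (join m n i)  ≡⟨ cong (splitAt m) eq ⟩
  splitAt m (join m n j)  ≡⟨ splitAt-join m n j ⟩
  j                       ∎
  where open ≡-Reasoning

take-⊕ : ∀ d₁ (x y : F2Vec (d₁ + d₂)) → take d₁ (x ⊕ y) ≡ take d₁ x ⊕ take d₁ y
take-⊕ d₁ = take-zipWith _xor_

collapse : ∀ d₁ → F2Vec (d₁ + d₂) → F2Vec (suc d₂)
collapse d₁ x = isNonZero (take d₁ x) ∷ drop d₁ x

collapse-⊕ : ∀ d₁ (x y : F2Vec (d₁ + d₂)) → SomeZero (take d₁ x) (take d₁ y) →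
             collapse d₁ (x ⊕ y) ≡ collapse d₁ x ⊕ collapse d₁ y
collapse-⊕ d₁ x y someZero =
  cong₂ _∷_ (trans (cong isNonZero (take-⊕ d₁ x y)) (isNonZero-⊕ someZero)) (drop-zipWith _xor_ x y)

collapse-≡0₂ : ∀ d₁ {x : F2Vec (d₁ + d₂)} → collapse d₁ x ≡ 0₂ → x ≡ 0₂
collapse-≡0₂ d₁ {x} eq = begin
  x                       ≡⟨ take++drop≡id d₁ x ⟨
  take d₁ x ++ drop d₁ x  ≡⟨ cong₂ _++_ (isNonZero≡false⇒≡0₂ (proj₁ (∷-injective eq)))
                                        (proj₂ (∷-injective eq)) ⟩
  0₂ {d₁} ++ 0₂           ≡⟨ replicate-++ d₁ false ⟩
  0₂                      ∎
  where open ≡-Reasoning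

collapse-≢ : ∀ d₁ (x y : F2Vec (d₁ + d₂)) → SomeZero (take d₁ x) (take d₁ y) →
             x ≢ y → collapse d₁ x ≢ collapse d₁ y
collapse-≢ d₁ x y someZero x≢y eq = x≢y (⊕≡0₂⇒≡ (collapse-≡0₂ d₁ (begin
  collapse d₁ (x ⊕ y)               ≡⟨ collapse-⊕ d₁ x y someZero ⟩
  collapse d₁ x ⊕ collapse d₁ y     ≡⟨ ≡⇒⊕≡0₂ eq ⟩
  0₂                                ∎)))
  where open ≡-Reasoning

module Product {c₁ : F2Vec d₁ → Fin (suc m₁)} (good₁ : Good c₁)
               {c₂ : F2Vec (suc d₂) → Fin m₂} (good₂ : Good c₂) where

  ownColour : F2Vec d₁ → Fin (suc m₁)
  ownColour q = if isNonZero q then c₁ q else zero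

  ownColour-nonZero : {q : F2Vec d₁} → NonZero₂ q → ownColour q ≡ c₁ q
  ownColour-nonZero {q} q≢0 = cong (λ b → if b then c₁ q else zero) (isNonZero-nonZero q≢0)

  ownColour-zero : {q : F2Vec d₁} → q ≡ 0₂ → ownColour q ≡ zero
  ownColour-zero {q} q≡0 = cong (λ b → if b then c₁ q else zero) (isNonZero-zero q≡0)

  ownColour-someZero : {q q' : F2Vec d₁} → SomeZero q q' →
                       ownColour q' ≡ ownColour q → ownColour (q ⊕ q') ≡ ownColour q →
                       ownColour q ≡ zero
  ownColour-someZero (inj₁ q≡0)        _  _  = ownColour-zero q≡0
  ownColour-someZero (inj₂ (inj₁ q'≡0)) e₁ _  = trans (sym e₁) (ownColour-zero q'≡0)
  ownColour-someZero (inj₂ (inj₂ s≡0))  _  e₂ = trans (sym e₂) (ownColour-zero s≡0)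

  merge : Fin (suc m₁) → Fin m₂ → Fin m₁ ⊎ Fin m₂
  merge zero    j = inj₂ j
  merge (suc i) _ = inj₁ i

  merge-injective : ∀ {a a' j j'} → merge a j ≡ merge a' j' → a ≡ a' × (a ≡ zero → j ≡ j')
  merge-injective {zero}  {zero}   eq = refl , λ _ → inj₂-injective eq
  merge-injective {suc _} {suc _}  eq = cong suc (inj₁-injective eq) , λ ()
  merge-injective {zero}  {suc _}  ()
  merge-injective {suc _} {zero}   ()

  colour : F2Vec (d₁ + d₂) → Fin m₁ ⊎ Fin m₂
  colour x = merge (ownColour (take d₁ x)) (c₂ (collapse d₁ x))

  colour-good : Good colour
  colour-good x y x≢0 y≢0 x≢y (e₁ , e₂) =
    [ c₁-monochromatic , c₂-monochromatic ]′ (allNonZero-or-someZero q q')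
    where
    q q' : F2Vec d₁
    q  = take d₁ x
    q' = take d₁ y

    own₁ : ownColour q' ≡ ownColour q
    own₁ = sym (proj₁ (merge-injective e₁))

    own₂ : ownColour (q ⊕ q') ≡ ownColour q
    own₂ = trans (cong ownColour (sym (take-⊕ d₁ x y))) (sym (proj₁ (merge-injective e₂)))

    c₁-monochromatic : AllNonZero q q' → ⊥
    c₁-monochromatic (q≢0 , q'≢0 , s≢0) =
      good₁ q q' q≢0 q'≢0 (s≢0 ∘ ≡⇒⊕≡0₂) (c₁-equal q'≢0 own₁ , c₁-equal s≢0 own₂)
      where
      c₁-equal : ∀ {v} → NonZero₂ v → ownColour v ≡ ownColour q → c₁ q ≡ c₁ v
      c₁-equal v≢0 e = trans (sym (ownColour-nonZero q≢0)) (trans (sym e) (ownColour-nonZero v≢0))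

    c₂-monochromatic : SomeZero q q' → ⊥
    c₂-monochromatic someZero =
      good₂ (collapse d₁ x) (collapse d₁ y)
        (x≢0 ∘ collapse-≡0₂ d₁) (y≢0 ∘ collapse-≡0₂ d₁) (collapse-≢ d₁ x y someZero x≢y)
        (proj₂ (merge-injective e₁) own≡0 ,
         trans (proj₂ (merge-injective e₂) own≡0) (cong c₂ (collapse-⊕ d₁ x y someZero)))
      where
      own≡0 : ownColour q ≡ zero
      own≡0 = ownColour-someZero someZero own₁ own₂

Colourable₂-product : Colourable₂ d₁ (suc m₁) → Colourable₂ (suc d₂) m₂ →
                      Colourable₂ (d₁ + d₂) (m₁ + m₂)
Colourable₂-product {m₁ = m₁} {m₂ = m₂} (_ , good₁) (_ , good₂) =
  recolour (Product.colour-good good₁ good₂) (join m₁ m₂) (join-injective m₁ m₂)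

Colourable₂-power : Colourable₂ (suc d) (suc m) → ∀ j → Colourable₂ (suc (j * d)) (suc (j * m))
Colourable₂-power _ zero = Colourable₂-1-1
Colourable₂-power {m = m} colourable (suc j) =
  subst (Colourable₂ _) (+-suc m (j * m))
    (Colourable₂-product colourable (Colourable₂-power colourable j))

bit : Fin 2 → Bool
bit zero    = false
bit (suc _) = true

bit-injective : Injective _≡_ _≡_ bit
bit-injective {zero}        {zero}        _ = refl
bit-injective {suc zero}    {suc zero}    _ = refl
bit-injective {zero}        {suc zero}    ()
bit-injective {suc zero}    {zero}        ()

remQuot-injective : ∀ {n} k → Injective _≡_ _≡_ (remQuot {n} k)
remQuot-injective {n} k {i} {j} eq = begin
  i                                   ≡⟨ combine-remQuot {n} k i ⟨
  uncurry combine (remQuot {n} k i)   ≡⟨ cong (uncurry combine) eq ⟩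
  uncurry combine (remQuot {n} k j)   ≡⟨ combine-remQuot {n} k j ⟩
  j                                   ∎
  where open ≡-Reasoning

toF2Vec : ∀ D → Fin (2 ^ D) → F2Vec D
toF2Vec zero    _ = []
toF2Vec (suc D) i = bit (proj₁ (remQuot {2} (2 ^ D) i)) ∷ toF2Vec D (proj₂ (remQuot {2} (2 ^ D) i))

toF2Vec-injective : ∀ D → Injective _≡_ _≡_ (toF2Vec D)
toF2Vec-injective zero    {zero} {zero} _ = refl
toF2Vec-injective (suc D) eq =
  remQuot-injective {2} (2 ^ D)
    (cong₂ _,_ (bit-injective (proj₁ (∷-injective eq)))
               (toF2Vec-injective D (proj₂ (∷-injective eq))))

Good⇒¬Arrows : ∀ {D M} {c : F2Vec D → Fin m} → Good c →
               (ι : Fin M → F2Vec D) → Injective _≡_ _≡_ ι → ¬ Arrows m M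
Good⇒¬Arrows {c = c} good ι ι-injective arrows with arrows (λ i j _ → c (ι i ⊕ ι j))
... | x , y , z , x<y , y<z , e₁ , e₂ =
  good (ι x ⊕ ι y) (ι y ⊕ ι z) (edge-nonZero x<y) (edge-nonZero y<z) edges-distinct
    (e₁ , trans e₂ (cong c (sym (⊕-telescope (ι x) (ι y) (ι z)))))
  where
  edge-nonZero : ∀ {i j} → i <ᶠ j → NonZero₂ (ι i ⊕ ι j)
  edge-nonZero i<j = <⇒≢ i<j ∘ ι-injective ∘ ⊕≡0₂⇒≡

  edges-distinct : ι x ⊕ ι y ≢ ι y ⊕ ι z
  edges-distinct eq = <⇒≢ (<-trans x<y y<z)
    (ι-injective (⊕≡0₂⇒≡ (trans (sym (⊕-telescope (ι x) (ι y) (ι z))) (≡⇒⊕≡0₂ eq))))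

Arrows⇒2^< : ∀ {k N D} → Arrows k N → Colourable₂ D m → m ≤ k → 2 ^ D < N
Arrows⇒2^< {N = N} {D} arrows colourable m≤k with N ≤? 2 ^ D
... | no  N≰2^D = ≰⇒> N≰2^D
... | yes N≤2^D =
  ⊥-elim (Good⇒¬Arrows (proj₂ (Colourable₂-weaken colourable m≤k)) ι ι-injective arrows)
  where
  ι : Fin N → F2Vec D
  ι i = toF2Vec D (inject≤ i N≤2^D)

  ι-injective : Injective _≡_ _≡_ ι
  ι-injective = inject≤-injective _ _ _ _ ∘ toF2Vec-injective D

R3-lowerBound : {R : ℕ → ℕ} → (∀ k → Arrows k (R k)) → Colourable₂ (suc d) (suc m) →
                ∀ j k → suc (j * m) ≤ k → (2 ^ d) ^ j ≤ R k
R3-lowerBound {d} {R = R} arrows colourable j k jm<k = begin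
  (2 ^ d) ^ j       ≡⟨ ^-*-assoc 2 d j ⟩
  2 ^ (d * j)       ≡⟨ cong (2 ^_) (*-comm d j) ⟩
  2 ^ (j * d)       ≤⟨ ^-monoʳ-≤ 2 (n≤1+n (j * d)) ⟩
  2 ^ suc (j * d)   ≤⟨ <⇒≤ (Arrows⇒2^< (arrows k) (Colourable₂-power colourable j) jm<k) ⟩
  R k               ∎
  where open ≤-Reasoning

-- Bernoulli's inequality (1 + 1/A)^j ≥ 1 + j/A, with the denominators cleared.
bernoulli : ∀ A j → A ^ j * (A + j) ≤ A * suc A ^ j
bernoulli A zero    = ≤-reflexive (unit A)
  where
  unit : ∀ A → 1 * (A + 0) ≡ A * 1
  unit = solve-∀
bernoulli A (suc j) = begin
  A * P * (A + suc j)           ≤⟨ m≤m+n _ (P * j) ⟩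
  A * P * (A + suc j) + P * j   ≡⟨ regroup A P j ⟩
  suc A * (P * (A + j))         ≤⟨ *-monoʳ-≤ (suc A) (bernoulli A j) ⟩
  suc A * (A * Q)               ≡⟨ x∙yz≈y∙xz (suc A) A Q ⟩
  A * (suc A * Q)               ∎
  where
  open ≤-Reasoning
  P Q : ℕ
  P = A ^ j
  Q = suc A ^ j
  regroup : ∀ A P j → A * P * (A + suc j) + P * j ≡ suc A * (P * (A + j))
  regroup = solve-∀

^-suc-≤ : ∀ A j → A * A ≤ j → A ^ suc j ≤ suc A ^ j
^-suc-≤ zero        _ _     = z≤n
^-suc-≤ A@(suc _) j A*A≤j = *-cancelˡ-≤ A (begin
  A * (A * P)       ≡⟨ x∙yz≈z∙yx A A P ⟩
  P * (A * A)       ≤⟨ *-monoʳ-≤ P (≤-trans A*A≤j (m≤n+m j A)) ⟩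
  P * (A + j)       ≤⟨ bernoulli A j ⟩
  A * suc A ^ j     ∎)
  where
  open ≤-Reasoning
  P : ℕ
  P = A ^ j

^-distribʳ-* : ∀ x y j → (x * y) ^ j ≡ x ^ j * y ^ j
^-distribʳ-* x y zero    = refl
^-distribʳ-* x y (suc j) =
  trans (cong (x * y *_) (^-distribʳ-* x y j)) ([m*n]*[o*p]≡[m*o]*[n*p] x y (x ^ j) (y ^ j))

eventually-^≤^* : (R : ℕ → ℕ) (T m a b : ℕ) .{{_ : NonZero b}} .{{_ : NonZero m}} →
                  (∀ j k → suc (j * m) ≤ k → T ^ j ≤ R k) → a ^ m < T * b ^ m →
                  ∃[ K ] ((k : ℕ) → K ≤ k → a ^ k ≤ b ^ k * R k)
eventually-^≤^* R T m zero      b _       _         = 1 , λ { (suc k) _ → z≤n }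
eventually-^≤^* R T m a@(suc _) b R-bound a^m<T*b^m = suc (A * A * m) , bound
  where
  A : ℕ
  A = a ^ m

  bound : ∀ k → suc (A * A * m) ≤ k → a ^ k ≤ b ^ k * R k
  bound (suc k) (s≤s A*A*m≤k) = begin
    a ^ suc k                 ≡⟨ cong (λ n → a ^ suc n) (m≡m%n+[m/n]*n k m) ⟩
    a ^ (suc r + j * m)       ≡⟨ ^-distribˡ-+-* a (suc r) (j * m) ⟩
    a ^ suc r * a ^ (j * m)   ≡⟨ cong (a ^ suc r *_) a^jm≡A^j ⟩
    a ^ suc r * A ^ j         ≤⟨ *-monoˡ-≤ (A ^ j) (^-monoʳ-≤ a (m%n<n k m)) ⟩
    A ^ suc j                 ≤⟨ ^-suc-≤ A j A*A≤j ⟩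
    suc A ^ j                 ≤⟨ ^-monoˡ-≤ j a^m<T*b^m ⟩
    (T * b ^ m) ^ j           ≡⟨ ^-distribʳ-* T (b ^ m) j ⟩
    T ^ j * (b ^ m) ^ j       ≤⟨ *-mono-≤ (R-bound j (suc k) (s≤s jm≤k)) b^mj≤b^k ⟩
    R (suc k) * b ^ suc k     ≡⟨ *-comm (R (suc k)) (b ^ suc k) ⟩
    b ^ suc k * R (suc k)     ∎
    where
    open ≤-Reasoning
    r j : ℕ
    r = k % m
    j = k / m

    jm≤k : j * m ≤ k
    jm≤k = m/n*n≤m k m

    A*A≤j : A * A ≤ j
    A*A≤j = subst (_≤ j) (m*n/n≡m (A * A) m) (/-monoˡ-≤ m A*A*m≤k)

    a^jm≡A^j : a ^ (j * m) ≡ A ^ j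
    a^jm≡A^j = trans (cong (a ^_) (*-comm j m)) (sym (^-*-assoc a m j))

    b^mj≤b^k : (b ^ m) ^ j ≤ b ^ suc k
    b^mj≤b^k = begin
      (b ^ m) ^ j   ≡⟨ ^-*-assoc b m j ⟩
      b ^ (m * j)   ≡⟨ cong (b ^_) (*-comm m j) ⟩
      b ^ (j * m)   ≤⟨ ^-monoʳ-≤ b (≤-trans jm≤k (n≤1+n k)) ⟩
      b ^ suc k     ∎

corollary6p2 : (R : ℕ → ℕ) → ((k : ℕ) → IsR3 k (R k)) →
    (d χ : ℕ) → 2 ≤ d → IsChi2 d χ →
    (a b : ℕ) → 1 ≤ b → a ^ (χ ∸ 1) < 2 ^ (d ∸ 1) * b ^ (χ ∸ 1) →
    ∃[ K ] ((k : ℕ) → K ≤ k → a ^ k ≤ b ^ k * R k)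
corollary6p2 _ _ _ zero       _   ((c , _) , _)  _ _ _ _ = ⊥-elim (¬Fin0 (c 0₂))
corollary6p2 _ _ _ (suc zero) 2≤d (colourable , _) _ _ _ _ = ⊥-elim (¬Colourable₂-1 2≤d colourable)
corollary6p2 R isR (suc (suc d)) (suc (suc m)) (s≤s (s≤s z≤n)) (colourable , _) a b 1≤b growth =
  eventually-^≤^* R (2 ^ suc d) (suc m) a b {{>-nonZero 1≤b}}
    (R3-lowerBound (proj₁ ∘ isR) colourable) growth
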